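{- Let $k,l,b\in\mathbb{N}$ with $k\ge 2$, and let $2\le m<2^{k+2}-1$. If $r_{b;2^{k+2}}>m$, then the equation $\sum_{i=1}^m x_i^{2^k l}=b$ has no solution in nonnegative integers.
   Context: $r_{b;c}$ denotes the remainder of the division of $b$ by $c$. -}

module Defs where

open import Data.Nat using (ℕ; zero; suc; _+_)
open import Data.Fin using (Fin; zero; suc)

sumFin : (n : ℕ) → (Fin n → ℕ) → ℕ
sumFin zero f = 0
sumFin (suc n) f = f zero + sumFin n (λ i → f (suc i))

-- For k ≥ 2 every (2^k l)-th power is 0 or 1 modulo 2^(k+2). For an odd base:
-- odd squares are 1 mod 8, and squaring lifts a ≡ 1 (mod 2^n) to a² ≡ 1 (mod 2^(n+1)),
-- so x^(2^k) ≡ 1 (mod 2^(k+2)). For an even base and l ≥ 1 the exponent 2^k l is at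
-- least k + 2. Hence a sum of m such powers has residue at most m modulo 2^(k+2).
module Submission where

open import Defs
open import Data.Nat using (ℕ; zero; suc; _+_; _*_; _^_; _≤_; _<_; _∸_; _%_; z≤n; s≤s; NonZero)
open import Data.Nat.Properties
open import Data.Nat.DivMod using (%-distribˡ-+; [m+kn]%n≡m%n; m%n≤m)
open import Data.Nat.Divisibility using (_∣_; ∣-refl; ∣-trans; *-pres-∣; m∣m*n; n∣m⇒m%n≡0)
open import Data.Nat.Tactic.RingSolver using (solve-∀)
open import Data.Fin using (Fin; zero; suc)
open import Data.Product using (Σ; ∃-syntax; _,_)
open import Data.Sum using (_⊎_; inj₁; inj₂)
open import Function using (_∘_)
open import Relation.Binary.PropositionalEquality
  using (_≡_; refl; sym; trans; cong; subst; module ≡-Reasoning)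
open import Relation.Nullary using (¬_)

data EvenOdd : ℕ → Set where
  even : ∀ y → EvenOdd (2 * y)
  odd  : ∀ y → EvenOdd (1 + 2 * y)

evenOdd : ∀ x → EvenOdd x
evenOdd zero = even 0
evenOdd (suc x) with evenOdd x
... | even y = odd y
... | odd y  = subst EvenOdd (2*[1+y]≡2+2y y) (even (suc y))
  where
  2*[1+y]≡2+2y : ∀ y → 2 * suc y ≡ 2 + 2 * y
  2*[1+y]≡2+2y = solve-∀

infix 4 _≡1[mod_]

_≡1[mod_] : ℕ → ℕ → Set
a ≡1[mod N ] = ∃[ q ] a ≡ 1 + q * N

≡0∨1[mod]⇒%≤1 : ∀ {a N} .{{_ : NonZero N}} → a ≡1[mod N ] ⊎ N ∣ a → a % N ≤ 1
≡0∨1[mod]⇒%≤1 {N = N} (inj₁ (q , refl)) = ≤-trans (≤-reflexive ([m+kn]%n≡m%n 1 q N)) (m%n≤m 1 N)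
≡0∨1[mod]⇒%≤1 {a} {N} (inj₂ N∣a) = ≤-trans (≤-reflexive (n∣m⇒m%n≡0 a N N∣a)) z≤n

≡1[mod]-^ : ∀ {a N} l → a ≡1[mod N ] → a ^ l ≡1[mod N ]
≡1[mod]-^ zero _ = 0 , refl
≡1[mod]-^ {N = N} (suc l) (q , refl) with ≡1[mod]-^ l (q , refl)
... | r , eq = q + r + q * r * N , trans (cong ((1 + q * N) *_) eq) (product q r N)
  where
  product : ∀ q r N → (1 + q * N) * (1 + r * N) ≡ 1 + (q + r + q * r * N) * N
  product = solve-∀

≡1[mod2^]-square : ∀ {a} n → a ≡1[mod 2 ^ suc n ] → a ^ 2 ≡1[mod 2 ^ suc (suc n) ]
≡1[mod2^]-square n (q , refl) = q + q * q * 2 ^ n , square q (2 ^ n)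
  where
  -- x ^ 2 is stated as its unfolding x * (x * 1): the ring solver does not reflect _^_.
  square : ∀ q P → (1 + q * (2 * P)) * ((1 + q * (2 * P)) * 1) ≡ 1 + (q + q * q * P) * (2 * (2 * P))
  square = solve-∀

odd²≡1[mod8] : ∀ y → (1 + 2 * y) ^ 2 ≡1[mod 8 ]
odd²≡1[mod8] y with evenOdd y
... | even w = w + 2 * (w * w) , square w
  where
  square : ∀ w → (1 + 2 * (2 * w)) * ((1 + 2 * (2 * w)) * 1) ≡ 1 + (w + 2 * (w * w)) * 8
  square = solve-∀
... | odd w = 1 + 3 * w + 2 * (w * w) , square w
  where
  square : ∀ w → (1 + 2 * (1 + 2 * w)) * ((1 + 2 * (1 + 2 * w)) * 1) ≡ 1 + (1 + 3 * w + 2 * (w * w)) * 8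
  square = solve-∀

odd^2^k≡1[mod2^[k+2]] : ∀ y k → 1 ≤ k → (1 + 2 * y) ^ 2 ^ k ≡1[mod 2 ^ (k + 2) ]
odd^2^k≡1[mod2^[k+2]] y (suc zero) _ = odd²≡1[mod8] y
odd^2^k≡1[mod2^[k+2]] y (suc (suc j)) _ =
  subst (_≡1[mod 2 ^ (suc (suc j) + 2) ]) a²≡a^2^[2+j]
    (≡1[mod2^]-square (j + 2) (odd^2^k≡1[mod2^[k+2]] y (suc j) (s≤s z≤n)))
  where
  open ≡-Reasoning
  a = 1 + 2 * y
  a²≡a^2^[2+j] : (a ^ 2 ^ suc j) ^ 2 ≡ a ^ 2 ^ suc (suc j)
  a²≡a^2^[2+j] = begin
    (a ^ 2 ^ suc j) ^ 2 ≡⟨ ^-*-assoc a (2 ^ suc j) 2 ⟩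
    a ^ (2 ^ suc j * 2) ≡⟨ cong (a ^_) (*-comm (2 ^ suc j) 2) ⟩
    a ^ 2 ^ suc (suc j) ∎

^-pres-∣ : ∀ {d a} n → d ∣ a → d ^ n ∣ a ^ n
^-pres-∣ zero _ = ∣-refl
^-pres-∣ (suc n) d∣a = *-pres-∣ d∣a (^-pres-∣ n d∣a)

^-monoʳ-∣ : ∀ a {m n} → m ≤ n → a ^ m ∣ a ^ n
^-monoʳ-∣ a {m} {n} m≤n = subst (a ^ m ∣_) a^m*a^[n∸m]≡a^n (m∣m*n (a ^ (n ∸ m)))
  where
  a^m*a^[n∸m]≡a^n : a ^ m * a ^ (n ∸ m) ≡ a ^ n
  a^m*a^[n∸m]≡a^n = trans (sym (^-distribˡ-+-* a m (n ∸ m))) (cong (a ^_) (m+[n∸m]≡n m≤n))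

2^m∣[2y]^n : ∀ y {m n} → m ≤ n → 2 ^ m ∣ (2 * y) ^ n
2^m∣[2y]^n y {m} {n} m≤n = ∣-trans (^-pres-∣ m (m∣m*n y)) (^-monoʳ-∣ (2 * y) m≤n)

k+2≤2^k : ∀ k → 2 ≤ k → k + 2 ≤ 2 ^ k
k+2≤2^k (suc zero) (s≤s ())
k+2≤2^k (suc (suc zero)) _ = ≤-refl
k+2≤2^k (suc k@(suc (suc _))) _ = begin
  suc k + 2       ≡⟨ +-comm 1 (k + 2) ⟩
  k + 2 + 1       ≤⟨ +-monoʳ-≤ (k + 2) (m^n>0 2 k) ⟩
  k + 2 + 2 ^ k   ≤⟨ +-monoˡ-≤ (2 ^ k) (k+2≤2^k k (s≤s (s≤s z≤n))) ⟩
  2 ^ k + 2 ^ k   ≡⟨ cong (2 ^ k +_) (sym (+-identityʳ (2 ^ k))) ⟩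
  2 ^ suc k       ∎
  where open ≤-Reasoning

^[2^k*l]≡0∨1[mod2^[k+2]] : ∀ k → 2 ≤ k → ∀ l x →
  x ^ (2 ^ k * l) ≡1[mod 2 ^ (k + 2) ] ⊎ 2 ^ (k + 2) ∣ x ^ (2 ^ k * l)
^[2^k*l]≡0∨1[mod2^[k+2]] k 2≤k l x with evenOdd x
... | odd y = inj₁ (subst (_≡1[mod 2 ^ (k + 2) ]) (^-*-assoc (1 + 2 * y) (2 ^ k) l)
  (≡1[mod]-^ l (odd^2^k≡1[mod2^[k+2]] y k (≤-trans (s≤s z≤n) 2≤k))))
^[2^k*l]≡0∨1[mod2^[k+2]] k _ zero _ | even y rewrite *-zeroʳ (2 ^ k) = inj₁ (0 , refl)
^[2^k*l]≡0∨1[mod2^[k+2]] k 2≤k (suc l) _ | even y = inj₂ (2^m∣[2y]^n y k+2≤2^k*[1+l])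
  where
  k+2≤2^k*[1+l] : k + 2 ≤ 2 ^ k * suc l
  k+2≤2^k*[1+l] = ≤-trans (k+2≤2^k k 2≤k) (m≤m*n (2 ^ k) (suc l))

%-subadditive : ∀ m n d .{{_ : NonZero d}} → (m + n) % d ≤ m % d + n % d
%-subadditive m n d = ≤-trans (≤-reflexive (%-distribˡ-+ m n d)) (m%n≤m (m % d + n % d) d)

sumFin-%≤ : ∀ d .{{_ : NonZero d}} n (f : Fin n → ℕ) → (∀ i → f i % d ≤ 1) → sumFin n f % d ≤ n
sumFin-%≤ d zero f _ = m%n≤m 0 d
sumFin-%≤ d (suc n) f f%d≤1 = ≤-trans (%-subadditive (f zero) (sumFin n (f ∘ suc)) d)
  (+-mono-≤ (f%d≤1 zero) (sumFin-%≤ d n (f ∘ suc) (f%d≤1 ∘ suc)))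

theorem6 : (k l b m : ℕ) → 2 ≤ k → 2 ≤ m → m < 2 ^ (k + 2) ∸ 1 →
    m < _%_ b (2 ^ (k + 2)) {{m^n≢0 2 (k + 2)}} →
    ¬ (Σ (Fin m → ℕ) (λ x → sumFin m (λ i → x i ^ (2 ^ k * l)) ≡ b))
theorem6 k l b m 2≤k _ _ m<b%N (x , Σpowers≡b) = <⇒≱ m<b%N (begin
  b % N                  ≡⟨ cong (_% N) (sym Σpowers≡b) ⟩
  sumFin m powers % N    ≤⟨ sumFin-%≤ N m powers powers%N≤1 ⟩
  m                      ∎)
  where
  open ≤-Reasoning
  N = 2 ^ (k + 2)
  instance
    N≢0 : NonZero N
    N≢0 = m^n≢0 2 (k + 2)
  powers : Fin m → ℕ
  powers i = x i ^ (2 ^ k * l)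
  powers%N≤1 : ∀ i → powers i % N ≤ 1
  powers%N≤1 i = ≡0∨1[mod]⇒%≤1 (^[2^k*l]≡0∨1[mod2^[k+2]] k 2≤k l (x i))
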